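{- Let $F$ be a field, let $\psi(t)\in F(t)$ be a rational function whose second Hasse–Schmidt derivative $\psi^{[2]}$ is nonzero, and let $A_1$ be a variable. Then $\psi'(t)+A_1$ and $\psi^{[2]}(t)$ have no common zero (in an algebraic closure of $F(A_1)$).
   Context: The first and second Hasse–Schmidt derivatives $\psi',\psi^{[2]}$ of $\psi\in F(t)$ are defined by $\psi(t+u)\equiv\psi(t)+\psi'(t)u+\psi^{[2]}(t)u^2\pmod{u^3}$. -}

module Defs where

open import Level using (Level; _⊔_)
open import Data.List using (List; []; _∷_; map; foldr; take)
open import Data.List.Relation.Unary.All using (All)
open import Data.Product using (Σ; ∃; _×_; _,_)
open import Relation.Nullary using (¬_)
open import Algebra.Bundles using (CommutativeRing; RawRing)
open import Algebra.Morphism.Structures using (module RingMorphisms)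

record Field (c ℓ : Level) : Set (Level.suc (c ⊔ ℓ)) where
  field
    commutativeRing : CommutativeRing c ℓ
  open CommutativeRing commutativeRing public
  field
    0≉1 : ¬ (0# ≈ 1#)
    inverse : ∀ x → ¬ (x ≈ 0#) → Σ Carrier (λ y → x * y ≈ 1#)

-- Univariate polynomials over a raw ring, as coefficient lists
-- (constant coefficient first).  Equality is "difference has all
-- coefficients ≈ 0", i.e. equality up to trailing zeros.

module PolyOps {c ℓ : Level} (R : RawRing c ℓ) where
  open RawRing R

  Poly : Set c
  Poly = List Carrier

  infixl 6 _+P_
  infixl 7 _*P_

  _+P_ : Poly → Poly → Poly
  []       +P q        = q
  (a ∷ p)  +P []       = a ∷ p
  (a ∷ p)  +P (b ∷ q)  = (a + b) ∷ (p +P q)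

  -P_ : Poly → Poly
  -P p = map -_ p

  scaleP : Carrier → Poly → Poly
  scaleP a p = map (a *_) p

  _*P_ : Poly → Poly → Poly
  []      *P q = []
  (a ∷ p) *P q = scaleP a q +P (0# ∷ (p *P q))

  IsZeroP : Poly → Set (c ⊔ ℓ)
  IsZeroP p = All (_≈ 0#) p

  _≈P_ : Poly → Poly → Set (c ⊔ ℓ)
  p ≈P q = IsZeroP (p +P (-P q))

  1P : Poly
  1P = 1# ∷ []

  XP : Poly
  XP = 0# ∷ 1# ∷ []

  evalP : Poly → Carrier → Carrier
  evalP p x = foldr (λ a acc → a + x * acc) 0# p

  polyRawRing : RawRing c (c ⊔ ℓ)
  polyRawRing = record
    { Carrier = Poly ; _≈_ = _≈P_ ; _+_ = _+P_ ; _*_ = _*P_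
    ; -_ = -P_ ; 0# = [] ; 1# = 1P }

module OverField {c ℓ : Level} (F : Field c ℓ) where
  open Field F using (rawRing)
  open PolyOps rawRing public

  -- F[t][u]: polynomials in u whose coefficients are polynomials in t
  module UPoly = PolyOps polyRawRing
  open UPoly using ()
    renaming (Poly to Poly₂; _+P_ to _+U_; _*P_ to _*U_; -P_ to -U_;
              IsZeroP to IsZeroU)

  constU : Poly → Poly₂
  constU p = p ∷ []

  t+u : Poly₂
  t+u = XP ∷ 1P ∷ []

  shift : Poly → Poly₂
  shift p = foldr (λ a acc → constU (a ∷ []) +U (t+u *U acc)) [] p

  _≡[u³]_ : Poly₂ → Poly₂ → Set (c ⊔ ℓ)
  X ≡[u³] Y = IsZeroU (take 3 (X +U (-U Y)))

  record RatFun : Set (c ⊔ ℓ) where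
    constructor _//_⟨_⟩
    field
      num : Poly
      den : Poly
      den≢0 : ¬ IsZeroP den
  open RatFun public

  _≈R_ : RatFun → RatFun → Set (c ⊔ ℓ)
  ρ ≈R σ = (num ρ *P den σ) ≈P (num σ *P den ρ)

  IsZeroR : RatFun → Set (c ⊔ ℓ)
  IsZeroR ρ = IsZeroP (num ρ)

  -- IsHasse ψ ψ₁ ψ₂ :  ψ(t+u) ≡ ψ(t) + ψ₁(t) u + ψ₂(t) u²  (mod u³)
  -- in F(t)[u].  Writing ψ = p/q, ψ₁ = a₁/b₁, ψ₂ = a₂/b₂, this is
  -- the congruence multiplied by the unit (mod u³) q(t+u)·q·b₁·b₂:
  --   p(t+u)·q b₁ b₂ ≡ q(t+u)·(p b₁ b₂ + a₁ q b₂ u + a₂ q b₁ u²)  (mod u³)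
  -- in F[t][u].
  IsHasse : RatFun → RatFun → RatFun → Set (c ⊔ ℓ)
  IsHasse ψ ψ₁ ψ₂ =
    (shift p *U constU (q *P b₁ *P b₂))
      ≡[u³]
    (shift q *U ((p *P b₁ *P b₂) ∷ (a₁ *P q *P b₂) ∷ (a₂ *P q *P b₁) ∷ []))
    where
      p = num ψ ; q = den ψ
      a₁ = num ψ₁ ; b₁ = den ψ₁
      a₂ = num ψ₂ ; b₂ = den ψ₂

  module Extension {c' ℓ' : Level} (K : Field c' ℓ')
                   (ι : Field.Carrier F → Field.Carrier K) where
    open Field K using () renaming (Carrier to K₀; _≈_ to _≈K_;
                                    _*_ to _*K_; 0# to 0K)
    module PK = PolyOps (Field.rawRing K)

    evalAt : Poly → K₀ → K₀
    evalAt p α = PK.evalP (map ι p) α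

    Transcendental : K₀ → Set (c ⊔ ℓ ⊔ ℓ')
    Transcendental a = ∀ (P : Poly) → evalAt P a ≈K 0K → IsZeroP P

    ValueAt : RatFun → K₀ → K₀ → Set (c ⊔ ℓ ⊔ ℓ')
    ValueAt ρ α v = Σ RatFun λ σ → (σ ≈R ρ)
                      × ¬ (evalAt (den σ) α ≈K 0K)
                      × (evalAt (num σ) α ≈K (v *K evalAt (den σ) α))

module Submission where

-- Suppose α ∈ K is a common zero,
-- i.e. ψ₂(α) = 0 and ψ₁(α) = -A₁.  Then α is a root of the nonzero numerator
-- of ψ₂, so it is algebraic over F: for some d, α^d lies in the F-span
-- V_d = F + Fα + … + Fα^(d-1), and V_d is then stable under multiplication
-- by every p(α), p ∈ F[t].  Writing ψ₁ = a/b with β = b(α) ≠ 0 we have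
-- A₁β = -a(α), so the d+1 elements A₁^j β^d = (-a(α))^j β^(d-j), j ≤ d,
-- all lie in V_d.  More than d elements of V_d are F-linearly dependent, so
-- β^d P(A₁) = 0 for a nonzero P ∈ F[t]; hence P(A₁) = 0, contradicting the
-- transcendence of A₁.
--
-- Equality in F is not decidable, so the case distinctions (leading
-- coefficient, pivot search in Gaussian elimination) are made in the
-- double-negation monad, which suffices because the goal is a negation.

open import Defs
open import Level using (Level; _⊔_)
open import Data.Empty using (⊥-elim)
open import Data.Maybe using (nothing)
open import Data.Nat using (ℕ; zero; suc; pred; _<_) renaming (_+_ to _+ℕ_)
open import Data.Nat.Properties using (+-suc; n<1+n; ≤-pred; <⇒≤)
open import Data.List using (List; []; _∷_; length; _++_; replicate)
open import Data.List.Properties using (length-++; length-++-sucʳ; length-replicate)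
open import Data.List.Relation.Unary.All using (All; []; _∷_)
open import Data.List.Relation.Unary.All.Properties using (++⁺; ++⁻)
open import Data.Product using (Σ; _×_; _,_)
open import Data.Sum using (_⊎_; inj₁; inj₂)
open import Relation.Nullary using (¬_; yes; no)
open import Relation.Nullary.Decidable using (¬¬-excluded-middle)
open import Relation.Nullary.Negation using (DoubleNegation; ¬¬-map; negated-stable; contradiction)
open import Relation.Binary.PropositionalEquality as P using (_≡_)
open import Algebra.Bundles using (Semiring)
open import Algebra.Morphism.Structures using (module RingMorphisms)
open import Tactic.RingSolver.Core.AlmostCommutativeRing using (fromCommutativeRing)
import Tactic.RingSolver.NonReflective as RingSolver
import Algebra.Definitions.RawSemiring as RawSemiringDefinitions
import Algebra.Properties.Ring as RingProperties
import Algebra.Properties.AbelianGroup as AbelianGroupProperties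
import Relation.Binary.Reasoning.Setoid as SetoidReasoning

return : ∀ {a} {A : Set a} → A → DoubleNegation A
return x = contradiction x

_>>=_ : ∀ {a b} {A : Set a} {B : Set b} →
        DoubleNegation A → (A → DoubleNegation B) → DoubleNegation B
m >>= f = negated-stable (¬¬-map f m)

split-by-length : ∀ {a b} {A : Set a} {B : Set b} (l₁ : List A) {l₂ : List A} (cs : List B) →
                  length cs ≡ length (l₁ ++ l₂) →
                  Σ (List B) λ c₁ → Σ (List B) λ c₂ →
                    cs ≡ c₁ ++ c₂ × length c₁ ≡ length l₁ × length c₂ ≡ length l₂
split-by-length []       cs       e = [] , cs , P.refl , P.refl , e
split-by-length (_ ∷ l₁) []       ()
split-by-length (_ ∷ l₁) (c ∷ cs) e with split-by-length l₁ cs (P.cong pred e)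
... | c₁ , c₂ , P.refl , e₁ , e₂ = c ∷ c₁ , c₂ , P.refl , P.cong suc e₁ , e₂

module FieldFacts {c ℓ : Level} (K : Field c ℓ) where
  open Field K hiding (zero)
  open RawSemiringDefinitions (Semiring.rawSemiring semiring) public using (_^_)

  1≉0 : ¬ 1# ≈ 0#
  1≉0 e = 0≉1 (sym e)

  cancelˡ : ∀ {x y} → ¬ x ≈ 0# → x * y ≈ 0# → y ≈ 0#
  cancelˡ {x} {y} x≉0 xy≈0 with inverse x x≉0
  ... | x⁻¹ , xx⁻¹≈1 =
    trans (sym (*-identityˡ y))
     (trans (*-congʳ (trans (sym xx⁻¹≈1) (*-comm x x⁻¹)))
      (trans (*-assoc x⁻¹ x y) (trans (*-congˡ xy≈0) (zeroʳ x⁻¹))))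

  *-nonzero : ∀ {x y} → ¬ x ≈ 0# → ¬ y ≈ 0# → ¬ x * y ≈ 0#
  *-nonzero x≉0 y≉0 xy≈0 = y≉0 (cancelˡ x≉0 xy≈0)

  ^-nonzero : ∀ {x} n → ¬ x ≈ 0# → ¬ x ^ n ≈ 0#
  ^-nonzero zero    x≉0 = 1≉0
  ^-nonzero (suc n) x≉0 = *-nonzero x≉0 (^-nonzero n x≉0)

module Argument {c ℓ c' ℓ' : Level} (F : Field c ℓ) (K : Field c' ℓ')
  (ι : Field.Carrier F → Field.Carrier K)
  (hom : RingMorphisms.IsRingHomomorphism (Field.rawRing F) (Field.rawRing K) ι)
  (α : Field.Carrier K) where

  open OverField F
  open Extension K ι
  open Field F using () renaming
    (Carrier to F₀; _≈_ to _≈F_; _+_ to _+F_; _*_ to _*F_; -_ to -F_; 0# to 0F; 1# to 1F)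
  open Field K hiding (zero)
  open FieldFacts K
  open RingMorphisms.IsRingHomomorphism hom
  open RingProperties ring using (-0#≈0#; -‿distribˡ-*; -‿distribʳ-*; -‿+-comm)
  open AbelianGroupProperties +-abelianGroup using (inverseʳ-unique; x∙y⁻¹≈ε⇒x≈y)
  open RingSolver (fromCommutativeRing commutativeRing (λ _ → nothing))
  module ≈-Reasoning = SetoidReasoning setoid

  K₀ : Set c'
  K₀ = Carrier

  ι-nonzero : ∀ x → ¬ x ≈F 0F → ¬ ι x ≈ 0#
  ι-nonzero x x≉0 ιx≈0 with Field.inverse F x x≉0
  ... | x⁻¹ , xx⁻¹≈1 = 0≉1
    (trans (sym (zeroˡ (ι x⁻¹)))
     (trans (*-congʳ (sym ιx≈0))
      (trans (sym (*-homo x x⁻¹)) (trans (⟦⟧-cong xx⁻¹≈1) 1#-homo))))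

  ι-divide : ∀ a h h⁻¹ → h *F h⁻¹ ≈F 1F → ι h * ι (a *F h⁻¹) ≈ ι a
  ι-divide a h h⁻¹ hh⁻¹≈1 =
    trans (*-congˡ (*-homo a h⁻¹))
     (trans (sym (*-assoc _ _ _))
      (trans (*-congʳ (*-comm _ _))
       (trans (*-assoc _ _ _)
        (trans (*-congˡ (trans (sym (*-homo h h⁻¹)) (trans (⟦⟧-cong hh⁻¹≈1) 1#-homo)))
         (*-identityʳ _)))))

  horner-+ : ∀ A B C D E → (A + B) + C * (D + E) ≈ (A + C * D) + (B + C * E)
  horner-+ = solve 5 (λ A B C D E → ((A ⊕ B) ⊕ (C ⊗ (D ⊕ E))) ⊜ ((A ⊕ (C ⊗ D)) ⊕ (B ⊕ (C ⊗ E)))) refl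

  horner-scale : ∀ A X C D → A * X + C * (A * D) ≈ A * (X + C * D)
  horner-scale = solve 4 (λ A X C D → ((A ⊗ X) ⊕ (C ⊗ (A ⊗ D))) ⊜ (A ⊗ (X ⊕ (C ⊗ D)))) refl

  horner-* : ∀ A Q C P → A * Q + C * (P * Q) ≈ (A + C * P) * Q
  horner-* = solve 4 (λ A Q C P → ((A ⊗ Q) ⊕ (C ⊗ (P ⊗ Q))) ⊜ ((A ⊕ (C ⊗ P)) ⊗ Q)) refl

  ev : Poly → K₀
  ev p = evalAt p α

  ev-zero : ∀ p → IsZeroP p → ev p ≈ 0#
  ev-zero []      _        = refl
  ev-zero (a ∷ p) (a≈0 ∷ z) =
    trans (+-cong (trans (⟦⟧-cong a≈0) 0#-homo) (trans (*-congˡ (ev-zero p z)) (zeroʳ α)))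
          (+-identityˡ 0#)

  ev-+ : ∀ p q → ev (p +P q) ≈ ev p + ev q
  ev-+ []      q       = sym (+-identityˡ _)
  ev-+ (a ∷ p) []      = sym (+-identityʳ _)
  ev-+ (a ∷ p) (b ∷ q) = trans (+-cong (+-homo a b) (*-congˡ (ev-+ p q))) (horner-+ _ _ _ _ _)

  ev-neg : ∀ p → ev (-P p) ≈ - ev p
  ev-neg []      = sym -0#≈0#
  ev-neg (a ∷ p) =
    trans (+-cong (-‿homo a) (trans (*-congˡ (ev-neg p)) (sym (-‿distribʳ-* α (ev p)))))
          (-‿+-comm _ _)

  ev-scale : ∀ a q → ev (scaleP a q) ≈ ι a * ev q
  ev-scale a []      = sym (zeroʳ _)
  ev-scale a (b ∷ q) = trans (+-cong (*-homo a b) (*-congˡ (ev-scale a q))) (horner-scale _ _ _ _)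

  ev-* : ∀ p q → ev (p *P q) ≈ ev p * ev q
  ev-* []      q = sym (zeroˡ _)
  ev-* (a ∷ p) q =
    trans (ev-+ (scaleP a q) (0F ∷ (p *P q)))
     (trans (+-cong (ev-scale a q) (trans (+-cong 0#-homo (*-congˡ (ev-* p q))) (+-identityˡ _)))
      (horner-* _ _ _ _))

  -- The F-span V_n = F + Fα + … + Fα^(n-1), described in Horner form:
  -- V_0 = 0 and y ∈ V_(n+1) iff y = ι h + α Y with Y ∈ V_n.

  data InSpan : ℕ → K₀ → Set (c ⊔ c' ⊔ ℓ') where
    nil    : ∀ {y} → y ≈ 0# → InSpan zero y
    horner : ∀ {n y} (h : F₀) (Y : K₀) → InSpan n Y → y ≈ ι h + α * Y → InSpan (suc n) y

  span-resp : ∀ {n x y} → x ≈ y → InSpan n x → InSpan n y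
  span-resp x≈y (nil x≈0)          = nil (trans (sym x≈y) x≈0)
  span-resp x≈y (horner h Y Y∈ e) = horner h Y Y∈ (trans (sym x≈y) e)

  span-0 : ∀ n → InSpan n 0#
  span-0 zero    = nil refl
  span-0 (suc n) = horner 0F 0# (span-0 n) (sym (trans (+-cong 0#-homo (zeroʳ α)) (+-identityˡ 0#)))

  span-+ : ∀ {n x y} → InSpan n x → InSpan n y → InSpan n (x + y)
  span-+ (nil x≈0) (nil y≈0) = nil (trans (+-cong x≈0 y≈0) (+-identityˡ 0#))
  span-+ (horner h X X∈ ex) (horner g Y Y∈ ey) =
    horner (h +F g) (X + Y) (span-+ X∈ Y∈)
      (trans (+-cong ex ey) (sym (trans (+-congʳ (+-homo h g)) (horner-+ _ _ _ _ _))))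

  span-scale : ∀ {n y} a → InSpan n y → InSpan n (ι a * y)
  span-scale a (nil y≈0)         = nil (trans (*-congˡ y≈0) (zeroʳ _))
  span-scale a (horner h Y Y∈ e) =
    horner (a *F h) (ι a * Y) (span-scale a Y∈)
      (trans (*-congˡ e) (trans (sym (horner-scale _ _ _ _)) (+-congʳ (sym (*-homo a h)))))

  span-neg : ∀ {n y} → InSpan n y → InSpan n (- y)
  span-neg (nil y≈0)         = nil (trans (-‿cong y≈0) -0#≈0#)
  span-neg (horner h Y Y∈ e) =
    horner (-F h) (- Y) (span-neg Y∈)
      (trans (-‿cong e) (sym (trans (+-cong (-‿homo h) (sym (-‿distribʳ-* α Y))) (-‿+-comm _ _))))

  span-α : ∀ {n y} → InSpan n y → InSpan (suc n) (α * y)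
  span-α {y = y} y∈ = horner 0F y y∈ (sym (trans (+-congʳ 0#-homo) (+-identityˡ _)))

  split-top : ∀ {n y} → InSpan (suc n) y → Σ F₀ λ g → Σ K₀ λ z → InSpan n z × y ≈ z + ι g * α ^ n
  split-top {zero} (horner h Y (nil Y≈0) e) =
    h , 0# , nil refl ,
    trans e (trans (+-congˡ (trans (*-congˡ Y≈0) (zeroʳ α)))
      (trans (+-identityʳ _) (sym (trans (+-identityˡ _) (*-identityʳ _)))))
  split-top {suc n} (horner h Y Y∈ e) with split-top Y∈
  ... | g , z , z∈ , Y≈ =
    g , ι h + α * z , horner h z z∈ refl ,
    trans e (trans (+-congˡ (*-congˡ Y≈)) (regroup _ _ _ _ _))
    where
    regroup : ∀ H A Z G P → H + A * (Z + G * P) ≈ (H + A * Z) + G * (A * P)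
    regroup = solve 5 (λ H A Z G P → (H ⊕ (A ⊗ (Z ⊕ (G ⊗ P)))) ⊜ ((H ⊕ (A ⊗ Z)) ⊕ (G ⊗ (A ⊗ P)))) refl

  -- 1 ∈ V_d whenever α^d ∈ V_d (for d = 0 both say 1 ≈ 0).
  one∈span : ∀ d → InSpan d (α ^ d) → InSpan d 1#
  one∈span zero    αᵈ∈V = αᵈ∈V
  one∈span (suc d) _    = horner 1F 0# (span-0 d) (sym (trans (+-cong 1#-homo (zeroʳ α)) (+-identityʳ _)))

  module StableSpan {d : ℕ} (αᵈ∈V : InSpan d (α ^ d)) where

    span-α-stable : ∀ {y} → InSpan d y → InSpan d (α * y)
    span-α-stable y∈ with split-top (span-α y∈)
    ... | g , z , z∈ , e = span-resp (sym e) (span-+ z∈ (span-scale g αᵈ∈V))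

    span-ev-stable : ∀ p {y} → InSpan d y → InSpan d (ev p * y)
    span-ev-stable []      y∈ = span-resp (sym (zeroˡ _)) (span-0 d)
    span-ev-stable (a ∷ p) y∈ =
      span-resp (horner-* _ _ _ _)
        (span-+ (span-scale a y∈) (span-α-stable (span-ev-stable p y∈)))

  LeadingForm : Poly → Set (c ⊔ ℓ ⊔ c' ⊔ ℓ')
  LeadingForm p = Σ ℕ λ d → Σ F₀ λ lc → ¬ lc ≈F 0F × Σ K₀ λ Z → InSpan d Z × ev p ≈ ι lc * (Z + α ^ d)

  leading-form : ∀ p → ¬ IsZeroP p → DoubleNegation (LeadingForm p)
  leading-form []      p≉0 = ⊥-elim (p≉0 [])
  leading-form (a ∷ p) ap≉0 = ¬¬-excluded-middle >>= λ where
      (yes p≈0) → ¬¬-excluded-middle >>= λ where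
        (yes a≈0) → ⊥-elim (ap≉0 (a≈0 ∷ p≈0))
        (no a≉0)  → return (0 , a , a≉0 , 0# , nil refl , constant-form p≈0)
      (no p≉0) → leading-form p p≉0 >>= λ where
        (d , lc , lc≉0 , Z , Z∈ , e) → return (shifted-form d lc lc≉0 Z Z∈ e (Field.inverse F lc lc≉0))
    where
    constant-form : IsZeroP p → ev (a ∷ p) ≈ ι a * (0# + α ^ 0)
    constant-form p≈0 =
      trans (+-congˡ (trans (*-congˡ (ev-zero p p≈0)) (zeroʳ α)))
       (trans (+-identityʳ _) (sym (trans (*-congˡ (+-identityˡ _)) (*-identityʳ _))))

    regroup : ∀ C X A Z P → C * X + A * (C * (Z + P)) ≈ C * ((X + A * Z) + A * P)
    regroup = solve 5 (λ C X A Z P → ((C ⊗ X) ⊕ (A ⊗ (C ⊗ (Z ⊕ P)))) ⊜ (C ⊗ ((X ⊕ (A ⊗ Z)) ⊕ (A ⊗ P)))) refl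

    -- a + α·lc (Z + α^d) = lc ((a/lc + α Z) + α^(d+1))
    shifted-form : ∀ d lc → ¬ lc ≈F 0F → ∀ Z → InSpan d Z → ev p ≈ ι lc * (Z + α ^ d) →
                   Σ F₀ (λ lc⁻¹ → lc *F lc⁻¹ ≈F 1F) → LeadingForm (a ∷ p)
    shifted-form d lc lc≉0 Z Z∈ e (lc⁻¹ , lclc⁻¹≈1) =
      suc d , lc , lc≉0 , ι (a *F lc⁻¹) + α * Z , horner (a *F lc⁻¹) Z Z∈ refl ,
      trans (+-cong (sym (ι-divide a lc lc⁻¹ lclc⁻¹≈1)) (*-congˡ e)) (regroup _ _ _ _ _)

  power-in-span : ∀ p → ¬ IsZeroP p → ev p ≈ 0# → DoubleNegation (Σ ℕ λ d → InSpan d (α ^ d))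
  power-in-span p p≉0 pα≈0 = leading-form p p≉0 >>= λ where
    (d , lc , lc≉0 , Z , Z∈ , e) →
      return (d , span-resp (sym (inverseʳ-unique Z (α ^ d)
                               (cancelˡ (ι-nonzero lc lc≉0) (trans (sym e) pα≈0))))
                            (span-neg Z∈))

  -- Linear dependence: more than n elements of V_n are F-linearly
  -- dependent.  Proof by Gaussian elimination on the constant coefficient.

  lin : List F₀ → List K₀ → K₀
  lin []       _        = 0#
  lin (_ ∷ _)  []       = 0#
  lin (a ∷ cs) (y ∷ ys) = ι a * y + lin cs ys

  Dependent : List K₀ → Set (c ⊔ ℓ ⊔ ℓ')
  Dependent ys = Σ (List F₀) λ cs → length cs ≡ length ys × ¬ IsZeroP cs × lin cs ys ≈ 0#

  lin-[] : ∀ cs → lin cs [] ≈ 0#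
  lin-[] []      = refl
  lin-[] (_ ∷ _) = refl

  lin-++ : ∀ c₁ {c₂} l₁ {l₂} → length c₁ ≡ length l₁ → lin (c₁ ++ c₂) (l₁ ++ l₂) ≈ lin c₁ l₁ + lin c₂ l₂
  lin-++ []       []       _ = sym (+-identityˡ _)
  lin-++ (a ∷ c₁) (y ∷ l₁) e = trans (+-congˡ (lin-++ c₁ l₁ (P.cong pred e))) (sym (+-assoc _ _ _))

  lin-zeros : ∀ k ys → lin (replicate k 0F) ys ≈ 0#
  lin-zeros zero    ys       = refl
  lin-zeros (suc k) []       = refl
  lin-zeros (suc k) (y ∷ ys) = trans (+-cong (trans (*-congʳ 0#-homo) (zeroˡ y)) (lin-zeros k ys)) (+-identityˡ 0#)

  AlphaMultiple : ℕ → K₀ → Set (c ⊔ c' ⊔ ℓ')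
  AlphaMultiple n y = Σ K₀ λ W → InSpan n W × y ≈ α * W

  quotients : ∀ {n ys} → All (AlphaMultiple n) ys → List K₀
  quotients []                = []
  quotients ((W , _ , _) ∷ ms) = W ∷ quotients ms

  quotients-span : ∀ {n ys} (ms : All (AlphaMultiple n) ys) → All (InSpan n) (quotients ms)
  quotients-span []                 = []
  quotients-span ((_ , W∈ , _) ∷ ms) = W∈ ∷ quotients-span ms

  quotients-length : ∀ {n ys} (ms : All (AlphaMultiple n) ys) → length (quotients ms) ≡ length ys
  quotients-length []       = P.refl
  quotients-length (_ ∷ ms) = P.cong suc (quotients-length ms)

  lin-quotients : ∀ {n ys} (ms : All (AlphaMultiple n) ys) cs → lin cs ys ≈ α * lin cs (quotients ms)
  lin-quotients []                 cs       = trans (lin-[] cs) (sym (trans (*-congˡ (lin-[] cs)) (zeroʳ α)))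
  lin-quotients (_ ∷ ms)           []       = sym (zeroʳ α)
  lin-quotients ((W , _ , e) ∷ ms) (a ∷ cs) =
    trans (+-cong (*-congˡ e) (lin-quotients ms cs)) (regroup _ _ _ _)
    where
    regroup : ∀ C A W L → C * (A * W) + A * L ≈ A * (C * W + L)
    regroup = solve 4 (λ C A W L → ((C ⊗ (A ⊗ W)) ⊕ (A ⊗ L)) ⊜ (A ⊗ ((C ⊗ W) ⊕ L))) refl

  lift-quotient-relation : ∀ {n ys} (ms : All (AlphaMultiple n) ys) → Dependent (quotients ms) → Dependent ys
  lift-quotient-relation ms (cs , len , cs≉0 , rel) =
    cs , P.trans len (quotients-length ms) , cs≉0 ,
    trans (lin-quotients ms cs) (trans (*-congˡ rel) (zeroʳ α))

  record Pivot (n : ℕ) (w : K₀) : Set (c ⊔ ℓ ⊔ c' ⊔ ℓ') where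
    field
      h h⁻¹   : F₀
      hh⁻¹≈1 : h *F h⁻¹ ≈F 1F
      W       : K₀
      W∈      : InSpan n W
      w≈      : w ≈ ι h + α * W

  -- Eliminating the constant coefficient of every element of V_(n+1)
  -- against a pivot w: yᵢ = (hᵢ/h) w + α (Yᵢ - (hᵢ/h) W).
  module Elimination {n : ℕ} {w : K₀} (pivot : Pivot n w) where
    open Pivot pivot

    reduce : ∀ {ys} → All (InSpan (suc n)) ys → List K₀
    reduce []                      = []
    reduce (horner hᵢ Yᵢ _ _ ∷ s) = (Yᵢ + - (ι (hᵢ *F h⁻¹) * W)) ∷ reduce s

    reduce-span : ∀ {ys} (s : All (InSpan (suc n)) ys) → All (InSpan n) (reduce s)
    reduce-span []                        = []
    reduce-span (horner hᵢ _ Yᵢ∈ _ ∷ s) = span-+ Yᵢ∈ (span-neg (span-scale (hᵢ *F h⁻¹) W∈)) ∷ reduce-span s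

    reduce-length : ∀ {ys} (s : All (InSpan (suc n)) ys) → length (reduce s) ≡ length ys
    reduce-length []                   = P.refl
    reduce-length (horner _ _ _ _ ∷ s) = P.cong suc (reduce-length s)

    -- the coefficient of w collected by the linear combination Σ ι(cᵢ) yᵢ
    weight : ∀ {ys} → List F₀ → All (InSpan (suc n)) ys → F₀
    weight []       _                      = 0F
    weight (_ ∷ _)  []                     = 0F
    weight (a ∷ cs) (horner hᵢ _ _ _ ∷ s) = a *F (hᵢ *F h⁻¹) +F weight cs s

    eliminate : ∀ hᵢ Yᵢ {y} → y ≈ ι hᵢ + α * Yᵢ →
                y ≈ ι (hᵢ *F h⁻¹) * w + α * (Yᵢ + - (ι (hᵢ *F h⁻¹) * W))
    eliminate hᵢ Yᵢ {y} y≈ = begin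
      y
        ≈⟨ y≈ ⟩
      ι hᵢ + α * Yᵢ
        ≈⟨ +-congʳ (sym (trans (*-comm _ _) (ι-divide hᵢ h h⁻¹ hh⁻¹≈1))) ⟩
      r * ι h + α * Yᵢ
        ≈⟨ sym (trans (+-congˡ (trans (*-congˡ (-‿inverseʳ _)) (zeroʳ α))) (+-identityʳ _)) ⟩
      (r * ι h + α * Yᵢ) + α * (r * W + - (r * W))
        ≈⟨ regroup r (ι h) α Yᵢ W (- (r * W)) ⟩
      r * (ι h + α * W) + α * (Yᵢ + - (r * W))
        ≈⟨ +-congʳ (*-congˡ (sym w≈)) ⟩
      r * w + α * (Yᵢ + - (r * W))
        ∎
      where
      open ≈-Reasoning
      r : K₀
      r = ι (hᵢ *F h⁻¹)
      regroup : ∀ R H A Y W N → (R * H + A * Y) + A * (R * W + N) ≈ R * (H + A * W) + A * (Y + N)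
      regroup = solve 6 (λ R H A Y W N →
        (((R ⊗ H) ⊕ (A ⊗ Y)) ⊕ (A ⊗ ((R ⊗ W) ⊕ N))) ⊜ ((R ⊗ (H ⊕ (A ⊗ W))) ⊕ (A ⊗ (Y ⊕ N)))) refl

    -- an empty combination, written in the shape of lin-reduce
    no-terms : 0# ≈ ι 0F * w + α * 0#
    no-terms = sym (trans (+-cong (trans (*-congʳ 0#-homo) (zeroˡ w)) (zeroʳ α)) (+-identityˡ 0#))

    lin-reduce : ∀ {ys} (s : All (InSpan (suc n)) ys) cs → lin cs ys ≈ ι (weight cs s) * w + α * lin cs (reduce s)
    lin-reduce s                        []       = no-terms
    lin-reduce []                       (_ ∷ _)  = no-terms
    lin-reduce (horner hᵢ Yᵢ _ e ∷ s) (a ∷ cs) =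
      trans (+-cong (*-congˡ (eliminate hᵢ Yᵢ e)) (lin-reduce s cs))
       (trans (regroup _ _ _ _ _ _ _) (+-congʳ (*-congʳ (sym (trans (+-homo _ _) (+-congʳ (*-homo _ _)))))))
      where
      regroup : ∀ W A C X R S L → C * (X * W + A * R) + (S * W + A * L) ≈ (C * X + S) * W + A * (C * R + L)
      regroup = solve 7 (λ W A C X R S L →
        ((C ⊗ ((X ⊗ W) ⊕ (A ⊗ R))) ⊕ ((S ⊗ W) ⊕ (A ⊗ L))) ⊜ ((((C ⊗ X) ⊕ S) ⊗ W) ⊕ (A ⊗ ((C ⊗ R) ⊕ L)))) refl

    -- A relation among the reduced elements lifts to one among the
    -- original elements, the pivot receiving minus the collected weight.
    lift-reduced-relation : ∀ {us ws} (su : All (InSpan (suc n)) us) (sw : All (InSpan (suc n)) ws) →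
                       Dependent (reduce su ++ reduce sw) → Dependent (us ++ w ∷ ws)
    lift-reduced-relation {us} {ws} su sw (cs , len , cs≉0 , rel) with split-by-length (reduce su) cs len
    ... | c₁ , c₂ , P.refl , len₁ , len₂ = c₁ ++ t ∷ c₂ , length-ok , nontrivial , relation
      where
      t : F₀
      t = -F (weight c₁ su +F weight c₂ sw)

      len₁′ : length c₁ ≡ length us
      len₁′ = P.trans len₁ (reduce-length su)

      length-ok : length (c₁ ++ t ∷ c₂) ≡ length (us ++ w ∷ ws)
      length-ok = P.trans (length-++ c₁)
        (P.trans (P.cong₂ _+ℕ_ len₁′ (P.cong suc (P.trans len₂ (reduce-length sw)))) (P.sym (length-++ us)))

      nontrivial : ¬ IsZeroP (c₁ ++ t ∷ c₂)
      nontrivial all≈0 with ++⁻ c₁ all≈0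
      ... | c₁≈0 , (_ ∷ c₂≈0) = cs≉0 (++⁺ c₁≈0 c₂≈0)

      weights-cancel : ι t + (ι (weight c₁ su) + ι (weight c₂ sw)) ≈ 0#
      weights-cancel = trans (+-cong (-‿homo _) (sym (+-homo _ _))) (-‿inverseˡ _)

      regroup : ∀ W A S₁ L₁ T S₂ L₂ →
                (S₁ * W + A * L₁) + (T * W + (S₂ * W + A * L₂)) ≈ (T + (S₁ + S₂)) * W + A * (L₁ + L₂)
      regroup = solve 7 (λ W A S₁ L₁ T S₂ L₂ →
        (((S₁ ⊗ W) ⊕ (A ⊗ L₁)) ⊕ ((T ⊗ W) ⊕ ((S₂ ⊗ W) ⊕ (A ⊗ L₂)))) ⊜ (((T ⊕ (S₁ ⊕ S₂)) ⊗ W) ⊕ (A ⊗ (L₁ ⊕ L₂)))) refl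

      relation : lin (c₁ ++ t ∷ c₂) (us ++ w ∷ ws) ≈ 0#
      relation = begin
        lin (c₁ ++ t ∷ c₂) (us ++ w ∷ ws)
          ≈⟨ lin-++ c₁ us len₁′ ⟩
        lin c₁ us + (ι t * w + lin c₂ ws)
          ≈⟨ +-cong (lin-reduce su c₁) (+-congˡ (lin-reduce sw c₂)) ⟩
        _ ≈⟨ regroup _ _ _ _ _ _ _ ⟩
        (ι t + (ι (weight c₁ su) + ι (weight c₂ sw))) * w + α * (lin c₁ (reduce su) + lin c₂ (reduce sw))
          ≈⟨ +-cong (*-congʳ weights-cancel) (*-congˡ (trans (sym (lin-++ c₁ (reduce su) len₁)) rel)) ⟩
        0# * w + α * 0#
          ≈⟨ trans (+-cong (zeroˡ w) (zeroʳ α)) (+-identityˡ 0#) ⟩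
        0# ∎
        where open ≈-Reasoning

  data PivotSplit (n : ℕ) : List K₀ → Set (c ⊔ ℓ ⊔ c' ⊔ ℓ') where
    split : ∀ {us w ws} → All (InSpan (suc n)) us → Pivot n w → All (InSpan (suc n)) ws →
            PivotSplit n (us ++ w ∷ ws)

  extend-split : ∀ {n y ys} → InSpan (suc n) y → PivotSplit n ys → PivotSplit n (y ∷ ys)
  extend-split y∈ (split su pivot sw) = split (y∈ ∷ su) pivot sw

  find-pivot : ∀ {n ys} → All (InSpan (suc n)) ys → DoubleNegation (All (AlphaMultiple n) ys ⊎ PivotSplit n ys)
  find-pivot []                            = return (inj₁ [])
  find-pivot (y∈@(horner h Y Y∈ y≈) ∷ s) = ¬¬-excluded-middle >>= λ where
      (no h≉0)  → return (inj₂ (split [] (pivot (Field.inverse F h h≉0)) s))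
      (yes h≈0) → find-pivot s >>= λ where
        (inj₁ ms) → return (inj₁ ((Y , Y∈ , α-multiple h≈0) ∷ ms))
        (inj₂ ps) → return (inj₂ (extend-split y∈ ps))
    where
    pivot : Σ F₀ (λ h⁻¹ → h *F h⁻¹ ≈F 1F) → Pivot _ _
    pivot (h⁻¹ , hh⁻¹≈1) = record { h = h ; h⁻¹ = h⁻¹ ; hh⁻¹≈1 = hh⁻¹≈1 ; W = Y ; W∈ = Y∈ ; w≈ = y≈ }

    α-multiple : h ≈F 0F → _ ≈ α * Y
    α-multiple h≈0 = trans y≈ (trans (+-congʳ (trans (⟦⟧-cong h≈0) 0#-homo)) (+-identityˡ _))

  -- In the pivot case the reduced family is one element shorter.
  dependent-with-pivot : ∀ {n ys} → PivotSplit n ys → suc n < length ys →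
                     (∀ zs → All (InSpan n) zs → n < length zs → DoubleNegation (Dependent zs)) →
                     DoubleNegation (Dependent ys)
  dependent-with-pivot {n} (split {us} {w} {ws} su pivot sw) n+1<len dependent-n =
    dependent-n (reduce su ++ reduce sw) (++⁺ (reduce-span su) (reduce-span sw)) n<len
      >>= λ dep → return (Elimination.lift-reduced-relation pivot su sw dep)
    where
    open Elimination pivot using (reduce; reduce-span; reduce-length)
    n<len : n < length (reduce su ++ reduce sw)
    n<len = P.subst (n <_)
      (P.trans (length-++ us) (P.sym (P.trans (length-++ (reduce su))
        (P.cong₂ _+ℕ_ (reduce-length su) (reduce-length sw)))))
      (≤-pred (P.subst (suc n <_) (length-++-sucʳ us w ws) n+1<len))

  dependent : ∀ n ys → All (InSpan n) ys → n < length ys → DoubleNegation (Dependent ys)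
  dependent zero    []       _               ()
  dependent zero    (y ∷ ys) (nil y≈0 ∷ _) _ =
    return (1F ∷ replicate (length ys) 0F , P.cong suc (length-replicate (length ys)) ,
            (λ { (1≈0 ∷ _) → Field.0≉1 F (Field.sym F 1≈0) }) ,
            trans (+-cong (trans (*-congˡ y≈0) (zeroʳ _)) (lin-zeros (length ys) ys)) (+-identityˡ 0#))
  dependent (suc n) ys s n+1<len = find-pivot s >>= λ where
    (inj₁ ms) → dependent n (quotients ms) (quotients-span ms)
                  (P.subst (n <_) (P.sym (quotients-length ms)) (<⇒≤ n+1<len))
                  >>= λ dep → return (lift-quotient-relation ms dep)
    (inj₂ ps) → dependent-with-pivot ps n+1<len (dependent n)

  module Transcendence {d : ℕ} (αᵈ∈V : InSpan d (α ^ d)) (A : K₀) (a b : Poly)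
                       (b≉0 : ¬ ev b ≈ 0#) (Ab≈-a : A * ev b ≈ - ev a) where
    open StableSpan αᵈ∈V

    β : K₀
    β = ev b

    -- A^j β^(j+k) = (-a(α))^j β^k, an element of V_d
    monomial : ℕ → ℕ → K₀
    monomial j k = A ^ j * β ^ (j +ℕ k)

    monomial∈V : ∀ j k → InSpan d (monomial j k)
    monomial∈V zero    zero    = span-resp (sym (*-identityˡ 1#)) (one∈span d αᵈ∈V)
    monomial∈V zero    (suc k) =
      span-resp (trans (*-congˡ (*-identityˡ _)) (sym (*-identityˡ _))) (span-ev-stable b (monomial∈V zero k))
    monomial∈V (suc j) k       =
      span-resp (sym (trans (interchange _ _ _ _) (trans (*-congʳ Ab≈-a) (sym (-‿distribˡ-* _ _)))))
        (span-neg (span-ev-stable a (monomial∈V j k)))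
      where
      interchange : ∀ X Y Z U → (X * Y) * (Z * U) ≈ (X * Z) * (Y * U)
      interchange = solve 4 (λ X Y Z U → ((X ⊗ Y) ⊗ (Z ⊗ U)) ⊜ ((X ⊗ Z) ⊗ (Y ⊗ U))) refl

    monomials : ℕ → ℕ → List K₀
    monomials zero    j = monomial j 0 ∷ []
    monomials (suc n) j = monomial j (suc n) ∷ monomials n (suc j)

    monomials∈V : ∀ n j → All (InSpan d) (monomials n j)
    monomials∈V zero    j = monomial∈V j 0 ∷ []
    monomials∈V (suc n) j = monomial∈V j (suc n) ∷ monomials∈V n (suc j)

    monomials-length : ∀ n j → length (monomials n j) ≡ suc n
    monomials-length zero    j = P.refl
    monomials-length (suc n) j = P.cong suc (monomials-length n (suc j))

    lin-monomials : ∀ n j cs → length cs ≡ suc n → lin cs (monomials n j) ≈ (A ^ j * β ^ (j +ℕ n)) * evalAt cs A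
    lin-monomials zero    j (c ∷ []) _ =
      trans (+-identityʳ _) (trans (*-comm _ _) (*-congˡ (sym (trans (+-congˡ (zeroʳ A)) (+-identityʳ _)))))
    lin-monomials (suc n) j (c ∷ cs) e rewrite +-suc j n =
      trans (+-congˡ (lin-monomials n (suc j) cs (P.cong pred e))) (factor _ _ _ _ _)
      where
      factor : ∀ C X B A E → C * (X * B) + ((A * X) * B) * E ≈ (X * B) * (C + A * E)
      factor C X B A E = sym (trans (distribˡ (X * B) C (A * E))
        (+-cong (*-comm _ _) (trans (sym (*-assoc _ _ _)) (*-congʳ (trans (*-comm _ _) (sym (*-assoc _ _ _)))))))

    not-transcendental : ¬ Transcendental A
    not-transcendental A-tr =
      dependent d (monomials d 0) (monomials∈V d 0)
        (P.subst (d <_) (P.sym (monomials-length d 0)) (n<1+n d)) λ where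
        (cs , len , cs≉0 , rel) →
          cs≉0 (A-tr cs (cancelˡ (*-nonzero 1≉0 (^-nonzero d b≉0))
                          (trans (sym (lin-monomials d 0 cs (P.trans len (monomials-length d 0)))) rel)))

  numerator-vanishes : ∀ ρ → ValueAt ρ α 0# → ev (num ρ) ≈ 0#
  numerator-vanishes ρ (σ , σ≈ρ , σ-den≉0 , σ-num≈) = cancelˡ σ-den≉0 (begin
      ev (den σ) * ev (num ρ)  ≈⟨ *-comm _ _ ⟩
      ev (num ρ) * ev (den σ)  ≈⟨ sym (ev-* (num ρ) (den σ)) ⟩
      ev (num ρ *P den σ)      ≈⟨ sym (x∙y⁻¹≈ε⇒x≈y _ _ cross-difference≈0) ⟩
      ev (num σ *P den ρ)      ≈⟨ ev-* (num σ) (den ρ) ⟩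
      ev (num σ) * ev (den ρ)  ≈⟨ *-congʳ (trans σ-num≈ (zeroˡ _)) ⟩
      0# * ev (den ρ)          ≈⟨ zeroˡ _ ⟩
      0#                       ∎)
    where
    open ≈-Reasoning
    cross-difference≈0 : ev (num σ *P den ρ) + - ev (num ρ *P den σ) ≈ 0#
    cross-difference≈0 =
      trans (sym (trans (ev-+ (num σ *P den ρ) (-P (num ρ *P den σ))) (+-congˡ (ev-neg (num ρ *P den σ)))))
            (ev-zero _ σ≈ρ)

  -- The theorem for fixed F, K, ι and α: ψ₂(α) = 0 makes α algebraic, and
  -- then ψ₁(α) = -A makes A algebraic.
  no-common-zero : (ψ₁ ψ₂ : RatFun) → ¬ IsZeroR ψ₂ → (A : K₀) → Transcendental A →
                   ¬ ((Σ K₀ λ v → ValueAt ψ₁ α v × v + A ≈ 0#) × ValueAt ψ₂ α 0#)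
  no-common-zero ψ₁ ψ₂ ψ₂≉0 A A-tr ((v , (τ , _ , τ-den≉0 , τ-num≈) , v+A≈0) , ψ₂α≈0) =
    power-in-span (num ψ₂) ψ₂≉0 (numerator-vanishes ψ₂ ψ₂α≈0) λ where
      (d , αᵈ∈V) → Transcendence.not-transcendental αᵈ∈V A (num τ) (den τ) τ-den≉0 Aβ≈-a A-tr
    where
    Aβ≈-a : A * ev (den τ) ≈ - ev (num τ)
    Aβ≈-a = trans (*-congʳ (inverseʳ-unique v A v+A≈0))
              (trans (sym (-‿distribˡ-* _ _)) (-‿cong (sym τ-num≈)))

lemma3p4 : {c ℓ c' ℓ' : Level} (F : Field c ℓ)
    → let open OverField F in
    (ψ ψ₁ ψ₂ : RatFun) → IsHasse ψ ψ₁ ψ₂ → ¬ IsZeroR ψ₂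
    → (K : Field c' ℓ') (ι : Field.Carrier F → Field.Carrier K)
    → RingMorphisms.IsRingHomomorphism (Field.rawRing F) (Field.rawRing K) ι
    → let open Extension K ι in
    (A₁ : Field.Carrier K) → Transcendental A₁
    → (α : Field.Carrier K)
    → ¬ ((Σ (Field.Carrier K) λ v → ValueAt ψ₁ α v × Field._≈_ K (Field._+_ K v A₁) (Field.0# K))
    × ValueAt ψ₂ α (Field.0# K))
lemma3p4 F ψ ψ₁ ψ₂ _ ψ₂≉0 K ι hom A₁ A₁-tr α =
  Argument.no-common-zero F K ι hom α ψ₁ ψ₂ ψ₂≉0 A₁ A₁-tr
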